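{- $\tilde{r}(P_3,P_3,P_3)\le 4$ and $\tilde{r}(P_3,P_3,P_4)\le 6$.
   Context: $P_m$ denotes the path on $m$ vertices. The three-color online Ramsey game for graphs $G_1,G_2,G_3$ is played by Builder and Painter on an infinite vertex set with initially no edges. In each round Builder draws an edge between two currently nonadjacent vertices, and Painter immediately colors it red, blue or green. Builder wins once the colored graph contains a red copy of $G_1$, a blue copy of $G_2$, or a green copy of $G_3$. The online Ramsey number $\tilde{r}(G_1,G_2,G_3)$ is the minimum number of rounds within which Builder can guarantee a win against every strategy of Painter. -}

module Defs where

open import Data.Nat using (ℕ; zero; suc)
open import Data.List using (List; []; _∷_; length)
open import Data.List.Membership.Propositional using (_∈_)
open import Data.List.Relation.Unary.Unique.Propositional using (Unique)
open import Data.Product using (_×_; _,_; Σ; ∃)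
open import Data.Sum using (_⊎_)
open import Data.Unit using (⊤)
open import Relation.Binary.PropositionalEquality using (_≡_; _≢_)
open import Relation.Nullary using (¬_)

data Colour : Set where
  red blue green : Colour

-- Board: vertices are natural numbers (an infinite vertex set); the
-- coloured graph is the list of coloured edges drawn so far, each
-- stored as (u , v , c) and meaning the undirected edge uv of colour c.
Board : Set
Board = List (ℕ × ℕ × Colour)

ColEdge : Board → Colour → ℕ → ℕ → Set
ColEdge B c u v = ((u , v , c) ∈ B) ⊎ ((v , u , c) ∈ B)

Adjacent : Board → ℕ → ℕ → Set
Adjacent B u v = ∃ λ c → ColEdge B c u v

ChainEdges : Board → Colour → List ℕ → Set
ChainEdges B c [] = ⊤
ChainEdges B c (x ∷ []) = ⊤
ChainEdges B c (x ∷ y ∷ r) = ColEdge B c x y × ChainEdges B c (y ∷ r)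

HasMonoPath : ℕ → Colour → Board → Set
HasMonoPath m c B =
  Σ (List ℕ) λ vs → length vs ≡ m × Unique vs × ChainEdges B c vs

BuilderGoal : ℕ → ℕ → ℕ → Board → Set
BuilderGoal a b d B =
  HasMonoPath a red B ⊎ HasMonoPath b blue B ⊎ HasMonoPath d green B

-- ForcedWin a b d n B : from position B, Builder can guarantee a win
-- within at most n further rounds, against every (adaptive) Painter.
data ForcedWin (a b d : ℕ) : ℕ → Board → Set where
  won  : ∀ {n B} → BuilderGoal a b d B → ForcedWin a b d n B
  move : ∀ {n B} (u v : ℕ) → u ≢ v → ¬ Adjacent B u v →
         ((c : Colour) → ForcedWin a b d n ((u , v , c) ∷ B)) →
         ForcedWin a b d (suc n) B

-- r̃(P_a, P_b, P_d) ≤ n : Builder can guarantee a win within n rounds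
-- starting from the empty graph.
OnlineRamseyPathsLE : ℕ → ℕ → ℕ → ℕ → Set
OnlineRamseyPathsLE a b d n = ForcedWin a b d n []

-- Builder draws spokes from vertex 0 to fresh leaves. Among four spokes two
-- share a colour, and two equally coloured spokes form a monochromatic P₃.
-- In the game (P₃, P₃, P₄), three spokes (plus a fourth when they are red,
-- blue and green) either repeat red or blue, or give green spokes 0x, 0y and
-- a red or blue spoke 0w; then the edges wx and wy force a red or blue P₃ or a
-- green P₄ within two moves. Against three green spokes 0x, 0y, 0z Builder
-- draws xy and xz; once x carries both red and blue, an edge from x to a fresh
-- vertex u completes a P₃ in either of them or the green P₄ u x 0 y.

module Submission where

open import Defs
open import Data.Empty using (⊥-elim)
open import Data.Fin using (Fin; zero; suc)
open import Data.Fin.Patterns using (0F; 1F; 2F)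
open import Data.Fin.Properties using (pigeonhole; <⇒≢; suc-injective)
open import Data.List using (List; []; _∷_; _++_; _∷ʳ_; length; lookup)
open import Data.List.Membership.Propositional using (_∈_)
open import Data.List.Relation.Unary.All using ([]; _∷_)
open import Data.List.Relation.Unary.AllPairs using ([]; _∷_)
open import Data.List.Relation.Unary.Any using (here; there)
open import Data.List.Properties using (length-++; ∷ʳ-++; ++-identityʳ)
open import Data.Nat using (ℕ; zero; suc; _+_; _≤_; _<_; z≤n; s≤s)
open import Data.Nat.Properties using (≤-refl; ≤-reflexive; m≤n⇒m≤1+n; <-irrefl; +-comm; n>0⇒n≢0)
open import Data.Product using (_×_; _,_; proj₁; proj₂)
import Data.Sum as Sum
open Sum using (_⊎_; inj₁; inj₂)
open import Data.Unit using (tt)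
open import Function using (_∘_)
open import Relation.Binary.PropositionalEquality
  using (_≡_; _≢_; refl; sym; trans; cong; subst; ≢-sym)
open import Relation.Nullary using (¬_; Dec; yes; no)

variable
  a b d m n : ℕ
  B : Board
  c e : Colour
  u v x y z t : ℕ

ColEdge-sym : ColEdge B c u v → ColEdge B c v u
ColEdge-sym = Sum.swap

ColEdge-∷ : ∀ {p} → ColEdge B c u v → ColEdge (p ∷ B) c u v
ColEdge-∷ = Sum.map there there

ColEdge-new : ColEdge ((u , v , c) ∷ B) c u v
ColEdge-new = inj₁ (here refl)

¬Adjacent-∷ : ¬ Adjacent B u v → ¬ (u ≡ x × v ≡ y) → ¬ (u ≡ y × v ≡ x) →
              ¬ Adjacent ((x , y , c) ∷ B) u v
¬Adjacent-∷ ¬uv ¬xy ¬yx (_ , inj₁ (here refl)) = ¬xy (refl , refl)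
¬Adjacent-∷ ¬uv ¬xy ¬yx (_ , inj₂ (here refl)) = ¬yx (refl , refl)
¬Adjacent-∷ ¬uv ¬xy ¬yx (c , inj₁ (there p))   = ¬uv (c , inj₁ p)
¬Adjacent-∷ ¬uv ¬xy ¬yx (c , inj₂ (there p))   = ¬uv (c , inj₂ p)

path₃ : ColEdge B c x y → ColEdge B c y z →
        x ≢ y → x ≢ z → y ≢ z → HasMonoPath 3 c B
path₃ {x = x} {y} {z} xy yz x≢y x≢z y≢z =
  x ∷ y ∷ z ∷ [] , refl , (x≢y ∷ x≢z ∷ []) ∷ (y≢z ∷ []) ∷ [] ∷ [] , xy , yz , tt

path₄ : ColEdge B c x y → ColEdge B c y z → ColEdge B c z t →
        x ≢ y → x ≢ z → x ≢ t → y ≢ z → y ≢ t → z ≢ t → HasMonoPath 4 c B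
path₄ {x = x} {y} {z} {t} xy yz zt x≢y x≢z x≢t y≢z y≢t z≢t =
  x ∷ y ∷ z ∷ t ∷ [] , refl ,
  (x≢y ∷ x≢z ∷ x≢t ∷ []) ∷ (y≢z ∷ y≢t ∷ []) ∷ (z≢t ∷ []) ∷ [] ∷ [] ,
  xy , yz , zt , tt

ForcedWin-suc : ForcedWin a b d n B → ForcedWin a b d (suc n) B
ForcedWin-suc (won goal)            = won goal
ForcedWin-suc (move u v u≢v ¬uv k) = move u v u≢v ¬uv (ForcedWin-suc ∘ k)

-- The colours in which a P₃ wins the game (P₃, P₃, P₄).
data Short : Colour → Set where
  red  : Short red
  blue : Short blue

short-or-green : ∀ c → Short c ⊎ c ≡ green
short-or-green red   = inj₁ red
short-or-green blue  = inj₁ blue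
short-or-green green = inj₂ refl

short-≟ : Short c → Short e → Dec (c ≡ e)
short-≟ red  red  = yes refl
short-≟ red  blue = no λ ()
short-≟ blue red  = no λ ()
short-≟ blue blue = yes refl

short-dichotomy : ∀ {f} → Short c → Short e → c ≢ e → Short f → f ≡ c ⊎ f ≡ e
short-dichotomy red  red  c≢e _    = ⊥-elim (c≢e refl)
short-dichotomy blue blue c≢e _    = ⊥-elim (c≢e refl)
short-dichotomy red  blue _   red  = inj₁ refl
short-dichotomy red  blue _   blue = inj₂ refl
short-dichotomy blue red  _   red  = inj₂ refl
short-dichotomy blue red  _   blue = inj₁ refl

short-goal : Short c → HasMonoPath m c B → BuilderGoal m m d B
short-goal red  = inj₁
short-goal blue = inj₂ ∘ inj₁

green-goal : HasMonoPath d green B → BuilderGoal a b d B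
green-goal = inj₂ ∘ inj₂

mono-goal : ∀ c → HasMonoPath m c B → BuilderGoal m m m B
mono-goal c with short-or-green c
... | inj₁ s    = short-goal s
... | inj₂ refl = green-goal

-- Colour lists are newest first: the spoke coloured by entry i leads to
-- leaf length cs ∸ toℕ i, and the next fresh leaf is suc (length cs).

star : List Colour → Board
star []       = []
star (c ∷ cs) = (0 , suc (length cs) , c) ∷ star cs

leaf : (cs : List Colour) → Fin (length cs) → ℕ
leaf (c ∷ cs) zero    = suc (length cs)
leaf (c ∷ cs) (suc i) = leaf cs i

∈-star : ∀ cs → (u , v , c) ∈ star cs → u ≡ 0 × 0 < v × v ≤ length cs
∈-star (c ∷ cs) (here refl) = refl , s≤s z≤n , ≤-refl
∈-star (c ∷ cs) (there p) with ∈-star cs p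
... | u≡0 , 0<v , v≤ = u≡0 , 0<v , m≤n⇒m≤1+n v≤

spoke∈ : ∀ cs i → (0 , leaf cs i , lookup cs i) ∈ star cs
spoke∈ (c ∷ cs) zero    = here refl
spoke∈ (c ∷ cs) (suc i) = there (spoke∈ cs i)

spoke : ∀ cs i → ColEdge (star cs) (lookup cs i) 0 (leaf cs i)
spoke cs i = inj₁ (spoke∈ cs i)

leaf-positive : ∀ cs i → 0 < leaf cs i
leaf-positive cs i = proj₁ (proj₂ (∈-star cs (spoke∈ cs i)))

leaf≤length : ∀ cs i → leaf cs i ≤ length cs
leaf≤length cs i = proj₂ (proj₂ (∈-star cs (spoke∈ cs i)))

leaf≢hub : ∀ cs i → leaf cs i ≢ 0
leaf≢hub cs i = n>0⇒n≢0 (leaf-positive cs i)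

leaf≢fresh : ∀ cs i → leaf cs i ≢ suc (length cs)
leaf≢fresh cs i eq = <-irrefl refl (subst (_≤ length cs) eq (leaf≤length cs i))

leaf-injective : ∀ cs {i j} → leaf cs i ≡ leaf cs j → i ≡ j
leaf-injective (c ∷ cs) {zero}  {zero}  _  = refl
leaf-injective (c ∷ cs) {zero}  {suc j} eq = ⊥-elim (leaf≢fresh cs j (sym eq))
leaf-injective (c ∷ cs) {suc i} {zero}  eq = ⊥-elim (leaf≢fresh cs i eq)
leaf-injective (c ∷ cs) {suc i} {suc j} eq = cong suc (leaf-injective cs eq)

leaves-distinct : ∀ cs {i j} → i ≢ j → leaf cs i ≢ leaf cs j
leaves-distinct cs i≢j = i≢j ∘ leaf-injective cs

leaves-nonadjacent : ∀ cs → 0 < u → 0 < v → ¬ Adjacent (star cs) u v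
leaves-nonadjacent cs 0<u 0<v (_ , inj₁ p) with ∈-star cs p
... | refl , _ = <-irrefl refl 0<u
leaves-nonadjacent cs 0<u 0<v (_ , inj₂ p) with ∈-star cs p
... | refl , _ = <-irrefl refl 0<v

fresh-nonadjacent : ∀ cs → ¬ Adjacent (star cs) u (suc (length cs))
fresh-nonadjacent cs (_ , inj₁ p) = <-irrefl refl (proj₂ (proj₂ (∈-star cs p)))
fresh-nonadjacent cs (_ , inj₂ p) with ∈-star cs p
... | () , _

coloured-spoke : ∀ cs i → lookup cs i ≡ c → ColEdge (star cs) c 0 (leaf cs i)
coloured-spoke cs i refl = spoke cs i

star-P₃ : ∀ cs {i j} → i ≢ j → lookup cs i ≡ lookup cs j →
          HasMonoPath 3 (lookup cs i) (star cs)
star-P₃ cs {i} {j} i≢j same =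
  path₃ (ColEdge-sym (spoke cs i)) (coloured-spoke cs j (sym same))
        (leaf≢hub cs i) (leaves-distinct cs i≢j) (≢-sym (leaf≢hub cs j))

draw-spokes : ∀ k n cs →
              (∀ ds → length ds ≡ k → ForcedWin a b d n (star (ds ++ cs))) →
              ForcedWin a b d (k + n) (star cs)
draw-spokes zero    n cs win = win [] refl
draw-spokes {a} {b} {d} (suc k) n cs win =
  move 0 (suc (length cs)) (λ ()) (fresh-nonadjacent cs) λ c →
    draw-spokes k n (c ∷ cs) λ ds len →
      subst (ForcedWin a b d n ∘ star) (∷ʳ-++ ds c cs)
            (win (ds ∷ʳ c) (trans (length-++ ds) (trans (cong (_+ 1) len) (+-comm k 1))))

spokes : ∀ k n → (∀ cs → length cs ≡ k → ForcedWin a b d n (star cs)) →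
         ForcedWin a b d (k + n) (star [])
spokes {a} {b} {d} k n win = draw-spokes k n [] λ ds len →
  subst (ForcedWin a b d n ∘ star) (sym (++-identityʳ ds)) (win ds len)

colour-index : Colour → Fin 3
colour-index red   = 0F
colour-index blue  = 1F
colour-index green = 2F

index-colour : Fin 3 → Colour
index-colour 0F = red
index-colour 1F = blue
index-colour 2F = green

index-colour∘colour-index : ∀ c → index-colour (colour-index c) ≡ c
index-colour∘colour-index red   = refl
index-colour∘colour-index blue  = refl
index-colour∘colour-index green = refl

colour-index-injective : colour-index c ≡ colour-index e → c ≡ e
colour-index-injective {c} {e} eq =
  trans (sym (index-colour∘colour-index c))
        (trans (cong index-colour eq) (index-colour∘colour-index e))

star-pigeonhole : ∀ cs → 3 < length cs → BuilderGoal 3 3 3 (star cs)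
star-pigeonhole cs 3<len with pigeonhole 3<len (colour-index ∘ lookup cs)
... | i , j , i<j , same =
  mono-goal _ (star-P₃ cs (<⇒≢ i<j) (colour-index-injective same))

finish-green-pair : ∀ cs {w x y} → Short (lookup cs w) →
                    lookup cs x ≡ green → lookup cs y ≡ green →
                    w ≢ x → w ≢ y → x ≢ y → ForcedWin 3 3 4 2 (star cs)
finish-green-pair cs {w} {x} {y} s x-green y-green w≢x w≢y x≢y =
  move W X W≢X (leaves-nonadjacent cs (leaf-positive cs w) (leaf-positive cs x)) colour-WX
  where
  W X Y : ℕ
  W = leaf cs w
  X = leaf cs x
  Y = leaf cs y
  W≢X : W ≢ X
  W≢X = leaves-distinct cs w≢x
  W≢Y : W ≢ Y
  W≢Y = leaves-distinct cs w≢y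
  X≢Y : X ≢ Y
  X≢Y = leaves-distinct cs x≢y
  W≢0 : W ≢ 0
  W≢0 = leaf≢hub cs w
  X≢0 : X ≢ 0
  X≢0 = leaf≢hub cs x
  Y≢0 : Y ≢ 0
  Y≢0 = leaf≢hub cs y
  0W : ColEdge (star cs) (lookup cs w) 0 W
  0W = spoke cs w
  0X : ColEdge (star cs) green 0 X
  0X = coloured-spoke cs x x-green
  0Y : ColEdge (star cs) green 0 Y
  0Y = coloured-spoke cs y y-green

  colour-WX : ∀ e → ForcedWin 3 3 4 1 ((W , X , e) ∷ star cs)
  colour-WX e with short-or-green e
  ... | inj₂ refl = won (green-goal
        (path₄ ColEdge-new (ColEdge-∷ (ColEdge-sym 0X)) (ColEdge-∷ 0Y)
               W≢X W≢0 W≢Y X≢0 X≢Y (≢-sym Y≢0)))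
  ... | inj₁ se with short-≟ s se
  ...   | yes refl = won (short-goal s
          (path₃ (ColEdge-sym ColEdge-new) (ColEdge-∷ (ColEdge-sym 0W)) (≢-sym W≢X) X≢0 W≢0))
  ...   | no c≢e = move W Y W≢Y ¬WY colour-WY
    where
    ¬WY : ¬ Adjacent ((W , X , e) ∷ star cs) W Y
    ¬WY = ¬Adjacent-∷ (leaves-nonadjacent cs (leaf-positive cs w) (leaf-positive cs y))
                      (X≢Y ∘ sym ∘ proj₂) (W≢X ∘ proj₁)
    colour-WY : ∀ f → ForcedWin 3 3 4 0 ((W , Y , f) ∷ (W , X , e) ∷ star cs)
    colour-WY f with short-or-green f
    ... | inj₂ refl = won (green-goal
          (path₄ ColEdge-new (ColEdge-∷ (ColEdge-∷ (ColEdge-sym 0Y))) (ColEdge-∷ (ColEdge-∷ 0X))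
                 W≢Y W≢0 W≢X Y≢0 (≢-sym X≢Y) (≢-sym X≢0)))
    ... | inj₁ sf with short-dichotomy s se c≢e sf
    ...   | inj₁ refl = won (short-goal s
            (path₃ (ColEdge-sym ColEdge-new) (ColEdge-∷ (ColEdge-∷ (ColEdge-sym 0W)))
                   (≢-sym W≢Y) Y≢0 W≢0))
    ...   | inj₂ refl = won (short-goal se
            (path₃ (ColEdge-∷ (ColEdge-sym ColEdge-new)) ColEdge-new (≢-sym W≢X) X≢Y W≢Y))

finish-green-triple : ∀ cs {x y z} →
                      lookup cs x ≡ green → lookup cs y ≡ green → lookup cs z ≡ green →
                      x ≢ y → x ≢ z → y ≢ z → ForcedWin 3 3 4 3 (star cs)
finish-green-triple cs {x} {y} {z} x-green y-green z-green x≢y x≢z y≢z =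
  move X Y X≢Y (leaves-nonadjacent cs (leaf-positive cs x) (leaf-positive cs y)) colour-XY
  where
  X Y Z U : ℕ
  X = leaf cs x
  Y = leaf cs y
  Z = leaf cs z
  U = suc (length cs)
  X≢Y : X ≢ Y
  X≢Y = leaves-distinct cs x≢y
  X≢Z : X ≢ Z
  X≢Z = leaves-distinct cs x≢z
  Y≢Z : Y ≢ Z
  Y≢Z = leaves-distinct cs y≢z
  X≢0 : X ≢ 0
  X≢0 = leaf≢hub cs x
  Y≢0 : Y ≢ 0
  Y≢0 = leaf≢hub cs y
  Z≢0 : Z ≢ 0
  Z≢0 = leaf≢hub cs z
  0X : ColEdge (star cs) green 0 X
  0X = coloured-spoke cs x x-green
  0Y : ColEdge (star cs) green 0 Y
  0Y = coloured-spoke cs y y-green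
  0Z : ColEdge (star cs) green 0 Z
  0Z = coloured-spoke cs z z-green

  colour-XY : ∀ e → ForcedWin 3 3 4 2 ((X , Y , e) ∷ star cs)
  colour-XY e with short-or-green e
  ... | inj₂ refl = won (green-goal
        (path₄ ColEdge-new (ColEdge-∷ (ColEdge-sym 0Y)) (ColEdge-∷ 0Z)
               X≢Y X≢0 X≢Z Y≢0 Y≢Z (≢-sym Z≢0)))
  ... | inj₁ se = move X Z X≢Z ¬XZ colour-XZ
    where
    ¬XZ : ¬ Adjacent ((X , Y , e) ∷ star cs) X Z
    ¬XZ = ¬Adjacent-∷ (leaves-nonadjacent cs (leaf-positive cs x) (leaf-positive cs z))
                      (Y≢Z ∘ sym ∘ proj₂) (X≢Y ∘ proj₁)
    colour-XZ : ∀ f → ForcedWin 3 3 4 1 ((X , Z , f) ∷ (X , Y , e) ∷ star cs)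
    colour-XZ f with short-or-green f
    ... | inj₂ refl = won (green-goal
          (path₄ ColEdge-new (ColEdge-∷ (ColEdge-∷ (ColEdge-sym 0Z))) (ColEdge-∷ (ColEdge-∷ 0Y))
                 X≢Z X≢0 X≢Y Z≢0 (≢-sym Y≢Z) (≢-sym Y≢0)))
    ... | inj₁ sf with short-≟ se sf
    ...   | yes refl = won (short-goal se
            (path₃ (ColEdge-∷ (ColEdge-sym ColEdge-new)) ColEdge-new (≢-sym X≢Y) Y≢Z X≢Z))
    ...   | no e≢f = move X U (≢-sym U≢X) ¬XU colour-XU
      where
      U≢X : U ≢ X
      U≢X = ≢-sym (leaf≢fresh cs x)
      U≢Y : U ≢ Y
      U≢Y = ≢-sym (leaf≢fresh cs y)
      U≢Z : U ≢ Z
      U≢Z = ≢-sym (leaf≢fresh cs z)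
      ¬XU : ¬ Adjacent ((X , Z , f) ∷ (X , Y , e) ∷ star cs) X U
      ¬XU = ¬Adjacent-∷ (¬Adjacent-∷ (fresh-nonadjacent cs) (U≢Y ∘ proj₂) (X≢Y ∘ proj₁))
                        (U≢Z ∘ proj₂) (X≢Z ∘ proj₁)
      colour-XU : ∀ g → ForcedWin 3 3 4 0 ((X , U , g) ∷ (X , Z , f) ∷ (X , Y , e) ∷ star cs)
      colour-XU g with short-or-green g
      ... | inj₂ refl = won (green-goal
            (path₄ (ColEdge-sym ColEdge-new) (ColEdge-∷ (ColEdge-∷ (ColEdge-∷ (ColEdge-sym 0X))))
                   (ColEdge-∷ (ColEdge-∷ (ColEdge-∷ 0Y)))
                   U≢X (λ ()) U≢Y X≢0 X≢Y (≢-sym Y≢0)))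
      ... | inj₁ sg with short-dichotomy se sf e≢f sg
      ...   | inj₁ refl = won (short-goal se
              (path₃ (ColEdge-sym ColEdge-new) (ColEdge-∷ (ColEdge-∷ ColEdge-new)) U≢X U≢Y X≢Y))
      ...   | inj₂ refl = won (short-goal sf
              (path₃ (ColEdge-sym ColEdge-new) (ColEdge-∷ ColEdge-new) U≢X U≢Z X≢Z))

three-shorts : ∀ cs {i j k} →
               Short (lookup cs i) → Short (lookup cs j) → Short (lookup cs k) →
               i ≢ j → i ≢ k → j ≢ k → BuilderGoal 3 3 d (star cs)
three-shorts cs si sj sk i≢j i≢k j≢k with short-≟ si sj
... | yes same = short-goal si (star-P₃ cs i≢j same)
... | no differ with short-dichotomy si sj differ sk
...   | inj₁ same = short-goal sk (star-P₃ cs (≢-sym i≢k) same)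
...   | inj₂ same = short-goal sk (star-P₃ cs (≢-sym j≢k) same)

two-shorts-and-green : ∀ cs {i j k} →
                       Short (lookup cs i) → Short (lookup cs j) → lookup cs k ≡ green →
                       i ≢ j → i ≢ k → j ≢ k → ForcedWin 3 3 4 3 (star cs)
two-shorts-and-green cs {i} {j} {k} si sj k-green i≢j i≢k j≢k with short-≟ si sj
... | yes same = won (short-goal si (star-P₃ cs i≢j same))
... | no differ = draw-spokes 1 2 cs λ { (c ∷ []) refl → fourth-spoke c }
  where
  fourth-spoke : ∀ c → ForcedWin 3 3 4 2 (star (c ∷ cs))
  fourth-spoke c with short-or-green c
  ... | inj₂ refl = finish-green-pair (green ∷ cs) {suc i} {suc k} {zero} si k-green refl
                      (i≢k ∘ suc-injective) (λ ()) (λ ())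
  ... | inj₁ sc with short-dichotomy si sj differ sc
  ...   | inj₁ same = won (short-goal sc (star-P₃ (c ∷ cs) {zero} {suc i} (λ ()) same))
  ...   | inj₂ same = won (short-goal sc (star-P₃ (c ∷ cs) {zero} {suc j} (λ ()) same))

after-three-spokes : ∀ cs → length cs ≡ 3 → ForcedWin 3 3 4 3 (star cs)
after-three-spokes cs@(c₁ ∷ c₂ ∷ c₃ ∷ []) refl
  with short-or-green c₁ | short-or-green c₂ | short-or-green c₃
... | inj₁ s₁ | inj₁ s₂ | inj₁ s₃ = won (three-shorts cs {0F} {1F} {2F} s₁ s₂ s₃ (λ ()) (λ ()) (λ ()))
... | inj₁ s₁ | inj₁ s₂ | inj₂ g₃ = two-shorts-and-green cs {0F} {1F} {2F} s₁ s₂ g₃ (λ ()) (λ ()) (λ ())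
... | inj₁ s₁ | inj₂ g₂ | inj₁ s₃ = two-shorts-and-green cs {0F} {2F} {1F} s₁ s₃ g₂ (λ ()) (λ ()) (λ ())
... | inj₂ g₁ | inj₁ s₂ | inj₁ s₃ = two-shorts-and-green cs {1F} {2F} {0F} s₂ s₃ g₁ (λ ()) (λ ()) (λ ())
... | inj₁ s₁ | inj₂ g₂ | inj₂ g₃ = ForcedWin-suc (finish-green-pair cs {0F} {1F} {2F} s₁ g₂ g₃ (λ ()) (λ ()) (λ ()))
... | inj₂ g₁ | inj₁ s₂ | inj₂ g₃ = ForcedWin-suc (finish-green-pair cs {1F} {0F} {2F} s₂ g₁ g₃ (λ ()) (λ ()) (λ ()))
... | inj₂ g₁ | inj₂ g₂ | inj₁ s₃ = ForcedWin-suc (finish-green-pair cs {2F} {0F} {1F} s₃ g₁ g₂ (λ ()) (λ ()) (λ ()))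
... | inj₂ g₁ | inj₂ g₂ | inj₂ g₃ = finish-green-triple cs {0F} {1F} {2F} g₁ g₂ g₃ (λ ()) (λ ()) (λ ())

theorem3p11 : OnlineRamseyPathsLE 3 3 3 4 × OnlineRamseyPathsLE 3 3 4 6
theorem3p11 =
  spokes 4 0 (λ cs len → won (star-pigeonhole cs (≤-reflexive (sym len)))) ,
  spokes 3 3 after-three-spokes
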